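{- For any $A\subseteq\mathbb{F}_2^n$ and any $a_1,a_2\in A$, \[ \bigl|\{(\beta_1,\beta_2)\in A\times A : \{a_1,a_2\}\subseteq A(\beta_1+\beta_2)\}\bigr| = \bigl|\{(c_1,\beta_2)\in A\times A : c_1\in A(a_1+a_2)\ \text{and}\ \beta_2\in A(a_1+c_1)\}\bigr|. \]
   Context: For $s\in\mathbb{F}_2^n$, $A(s) := A\cap(s+A) = \{a\in A : \exists a'\in A,\ s=a+a'\}$. -}

module Defs where

open import Data.Bool using (Bool; true; false; _∧_; _xor_; T)
open import Data.Vec using (Vec; []; _∷_; zipWith)
open import Data.List using (List; []; _∷_; map; concatMap; filterᵇ; length; cartesianProduct)
open import Data.Nat using (ℕ; zero; suc)
open import Data.Product using (_×_; _,_)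

F2^ : ℕ → Set
F2^ n = Vec Bool n

_⊕_ : ∀ {n} → F2^ n → F2^ n → F2^ n
_⊕_ = zipWith _xor_

Subset : ℕ → Set
Subset n = F2^ n → Bool

allVecs : (n : ℕ) → List (F2^ n)
allVecs zero = [] ∷ []
allVecs (suc n) = concatMap (λ v → (false ∷ v) ∷ (true ∷ v) ∷ []) (allVecs n)

-- A(s) := A ∩ (s + A); x ∈ s + A  iff  s + x ∈ A.
A⟨_⟩ : ∀ {n} → Subset n → F2^ n → Subset n
A⟨ A ⟩ s x = A x ∧ A (s ⊕ x)

countPairs : ∀ {n} → Subset n → (F2^ n → F2^ n → Bool) → ℕ
countPairs {n} A P =
  length (filterᵇ (λ { (x , y) → A x ∧ A y ∧ P x y })
                  (cartesianProduct (allVecs n) (allVecs n)))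

-- Fix β₂ and substitute c₁ = β₁ + β₂ + a₁ in the count on the left. Since
-- a₁, a₂ ∈ A, both sides then test membership in A of the same four points
-- β₁, β₂, β₁ + β₂ + a₁ and β₁ + β₂ + a₂, and translation by a fixed vector
-- permutes 𝔽₂ⁿ, so it does not change a sum over 𝔽₂ⁿ.
module Submission where

open import Defs
open import Algebra.Properties.CommutativeSemigroup as CommSemigroupProps using ()
open import Data.Bool using (Bool; true; false; _∧_; _xor_)
open import Data.Bool.Properties using (∧-comm; ∧-zeroʳ; xor-assoc; xor-comm; xor-same)
open import Data.List using (List; []; _∷_; map; concatMap; filterᵇ; length; cartesianProduct; _++_)
open import Data.List.Properties using (map-++; map-∘; map-cong)
open import Data.Nat using (ℕ; zero; suc; _+_)
open import Data.Nat.ListAction using (sum)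
open import Data.Nat.ListAction.Properties using (sum-++)
open import Data.Nat.Properties using (+-commutativeSemigroup)
open import Data.Product using (_×_; _,_)
open import Data.Vec using ([]; _∷_)
open import Data.Vec.Properties using (zipWith-assoc; zipWith-comm)
open import Function using (_∘_)
open import Relation.Binary.PropositionalEquality
  using (_≡_; _≗_; refl; sym; trans; cong; cong₂; module ≡-Reasoning)

open CommSemigroupProps +-commutativeSemigroup using (interchange; x∙yz≈y∙xz)
open ≡-Reasoning

toℕ : Bool → ℕ
toℕ true = 1
toℕ false = 0

∑ : {X : Set} → List X → (X → ℕ) → ℕ
∑ xs f = sum (map f xs)

∑-cong : {X : Set} {f g : X → ℕ} → f ≗ g → ∀ xs → ∑ xs f ≡ ∑ xs g
∑-cong f≗g xs = cong sum (map-cong f≗g xs)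

∑-++ : {X : Set} (f : X → ℕ) → ∀ xs ys → ∑ (xs ++ ys) f ≡ ∑ xs f + ∑ ys f
∑-++ f xs ys = trans (cong sum (map-++ f xs ys)) (sum-++ (map f xs) (map f ys))

∑-map : {X Y : Set} (f : Y → ℕ) (g : X → Y) → ∀ xs → ∑ (map g xs) f ≡ ∑ xs (f ∘ g)
∑-map f g xs = cong sum (sym (map-∘ xs))

∑-concatMap : {X Y : Set} (f : Y → ℕ) (g : X → List Y) → ∀ xs →
  ∑ (concatMap g xs) f ≡ ∑ xs (λ x → ∑ (g x) f)
∑-concatMap f g [] = refl
∑-concatMap f g (x ∷ xs) =
  trans (∑-++ f (g x) (concatMap g xs)) (cong (∑ (g x) f +_) (∑-concatMap f g xs))

∑-+ : {X : Set} (f g : X → ℕ) → ∀ xs → ∑ xs (λ x → f x + g x) ≡ ∑ xs f + ∑ xs g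
∑-+ f g [] = refl
∑-+ f g (x ∷ xs) =
  trans (cong (f x + g x +_) (∑-+ f g xs)) (interchange (f x) (g x) (∑ xs f) (∑ xs g))

∑-zero : {X : Set} → ∀ (xs : List X) → ∑ xs (λ _ → 0) ≡ 0
∑-zero [] = refl
∑-zero (_ ∷ xs) = ∑-zero xs

∑-comm : {X Y : Set} (h : X → Y → ℕ) → ∀ xs ys →
  ∑ xs (λ x → ∑ ys (h x)) ≡ ∑ ys (λ y → ∑ xs (λ x → h x y))
∑-comm h [] ys = sym (∑-zero ys)
∑-comm h (x ∷ xs) ys = begin
  ∑ ys (h x) + ∑ xs (λ x′ → ∑ ys (h x′))        ≡⟨ cong (∑ ys (h x) +_) (∑-comm h xs ys) ⟩
  ∑ ys (h x) + ∑ ys (λ y → ∑ xs (λ x′ → h x′ y)) ≡⟨ ∑-+ (h x) (λ y → ∑ xs (λ x′ → h x′ y)) ys ⟨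
  ∑ ys (λ y → h x y + ∑ xs (λ x′ → h x′ y))      ∎

∑-cartesianProduct : {X Y : Set} (f : X × Y → ℕ) → ∀ (xs : List X) (ys : List Y) →
  ∑ (cartesianProduct xs ys) f ≡ ∑ xs (λ x → ∑ ys (λ y → f (x , y)))
∑-cartesianProduct f [] ys = refl
∑-cartesianProduct f (x ∷ xs) ys = begin
  ∑ (map (x ,_) ys ++ cartesianProduct xs ys) f
    ≡⟨ ∑-++ f (map (x ,_) ys) (cartesianProduct xs ys) ⟩
  ∑ (map (x ,_) ys) f + ∑ (cartesianProduct xs ys) f
    ≡⟨ cong₂ _+_ (∑-map f (x ,_) ys) (∑-cartesianProduct f xs ys) ⟩
  ∑ ys (λ y → f (x , y)) + ∑ xs (λ x′ → ∑ ys (λ y → f (x′ , y))) ∎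

length-filterᵇ : {X : Set} (p : X → Bool) → ∀ xs → length (filterᵇ p xs) ≡ ∑ xs (toℕ ∘ p)
length-filterᵇ p [] = refl
length-filterᵇ p (x ∷ xs) with p x
... | true = cong suc (length-filterᵇ p xs)
... | false = length-filterᵇ p xs

countPairs≡∑∑ : ∀ {n} (A : Subset n) (P : F2^ n → F2^ n → Bool) →
  countPairs A P ≡ ∑ (allVecs n) (λ x → ∑ (allVecs n) (λ y → toℕ (A x ∧ A y ∧ P x y)))
countPairs≡∑∑ {n} A P =
  trans (length-filterᵇ _ (cartesianProduct (allVecs n) (allVecs n)))
        (∑-cartesianProduct _ (allVecs n) (allVecs n))

⊕-assoc : ∀ {n} (x y z : F2^ n) → (x ⊕ y) ⊕ z ≡ x ⊕ (y ⊕ z)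
⊕-assoc = zipWith-assoc xor-assoc

⊕-comm : ∀ {n} (x y : F2^ n) → x ⊕ y ≡ y ⊕ x
⊕-comm = zipWith-comm xor-comm

⊕-cancelˡ : ∀ {n} (x y : F2^ n) → x ⊕ (x ⊕ y) ≡ y
⊕-cancelˡ [] [] = refl
⊕-cancelˡ (a ∷ x) (b ∷ y) =
  cong₂ _∷_ (trans (sym (xor-assoc a a b)) (cong (_xor b) (xor-same a))) (⊕-cancelˡ x y)

⊕-cancelʳ : ∀ {n} (x y : F2^ n) → (x ⊕ y) ⊕ y ≡ x
⊕-cancelʳ x y = trans (⊕-comm (x ⊕ y) y) (trans (cong (y ⊕_) (⊕-comm x y)) (⊕-cancelˡ y x))

∑-allVecs-⊕ : ∀ n (t : F2^ n) (f : F2^ n → ℕ) →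
  ∑ (allVecs n) f ≡ ∑ (allVecs n) (λ x → f (x ⊕ t))
∑-allVecs-⊕ zero [] f = refl
∑-allVecs-⊕ (suc n) (b ∷ t) f = begin
  ∑ (allVecs (suc n)) f
    ≡⟨ ∑-concatMap f bitPair (allVecs n) ⟩
  ∑ (allVecs n) (λ v → ∑ (bitPair v) f)
    ≡⟨ ∑-allVecs-⊕ n t (λ v → ∑ (bitPair v) f) ⟩
  ∑ (allVecs n) (λ v → ∑ (bitPair (v ⊕ t)) f)
    ≡⟨ ∑-cong (λ v → flipFirst b (v ⊕ t)) (allVecs n) ⟩
  ∑ (allVecs n) (λ v → ∑ (bitPair v) (λ x → f (x ⊕ (b ∷ t))))
    ≡⟨ ∑-concatMap (λ x → f (x ⊕ (b ∷ t))) bitPair (allVecs n) ⟨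
  ∑ (allVecs (suc n)) (λ x → f (x ⊕ (b ∷ t))) ∎
  where
  bitPair : F2^ n → List (F2^ (suc n))
  bitPair v = (false ∷ v) ∷ (true ∷ v) ∷ []
  flipFirst : ∀ b w → f (false ∷ w) + (f (true ∷ w) + 0)
                    ≡ f ((false xor b) ∷ w) + (f ((true xor b) ∷ w) + 0)
  flipFirst false w = refl
  flipFirst true w = x∙yz≈y∙xz (f (false ∷ w)) (f (true ∷ w)) 0

∧-rearrange : ∀ p q r s → r ∧ q ∧ (r ∧ s) ∧ (q ∧ p) ≡ p ∧ q ∧ r ∧ s
∧-rearrange p q false s = sym (trans (cong (p ∧_) (∧-zeroʳ q)) (∧-zeroʳ p))
∧-rearrange false false true s = refl
∧-rearrange true false true s = refl
∧-rearrange p true true s = ∧-comm s p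

module _ {n} (A : Subset n) {a₁ a₂ : F2^ n} (A∋a₁ : A a₁ ≡ true) (A∋a₂ : A a₂ ≡ true) where

  sumCovers : F2^ n → F2^ n → Bool
  sumCovers β₁ β₂ = A β₁ ∧ A β₂ ∧ (A⟨ A ⟩ (β₁ ⊕ β₂) a₁ ∧ A⟨ A ⟩ (β₁ ⊕ β₂) a₂)

  chain : F2^ n → F2^ n → Bool
  chain c₁ β₂ = A c₁ ∧ A β₂ ∧ (A⟨ A ⟩ (a₁ ⊕ a₂) c₁ ∧ A⟨ A ⟩ (a₁ ⊕ c₁) β₂)

  chain-substitute : ∀ β₁ β₂ → chain ((β₁ ⊕ β₂) ⊕ a₁) β₂ ≡ sumCovers β₁ β₂
  chain-substitute β₁ β₂ = begin
    chain c₁ β₂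
      ≡⟨ cong₂ (λ u v → A c₁ ∧ A β₂ ∧ (A c₁ ∧ A u) ∧ (A β₂ ∧ A v)) shift-a₂ recover-β₁ ⟩
    A c₁ ∧ A β₂ ∧ (A c₁ ∧ A (s ⊕ a₂)) ∧ (A β₂ ∧ A β₁)
      ≡⟨ ∧-rearrange (A β₁) (A β₂) (A c₁) (A (s ⊕ a₂)) ⟩
    A β₁ ∧ A β₂ ∧ (true ∧ A c₁) ∧ (true ∧ A (s ⊕ a₂))
      ≡⟨ cong₂ (λ u v → A β₁ ∧ A β₂ ∧ (u ∧ A c₁) ∧ (v ∧ A (s ⊕ a₂))) (sym A∋a₁) (sym A∋a₂) ⟩
    sumCovers β₁ β₂ ∎
    where
    s c₁ : F2^ n
    s = β₁ ⊕ β₂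
    c₁ = s ⊕ a₁
    a₁⊕c₁ : a₁ ⊕ c₁ ≡ s
    a₁⊕c₁ = trans (cong (a₁ ⊕_) (⊕-comm s a₁)) (⊕-cancelˡ a₁ s)
    shift-a₂ : (a₁ ⊕ a₂) ⊕ c₁ ≡ s ⊕ a₂
    shift-a₂ = begin
      (a₁ ⊕ a₂) ⊕ c₁ ≡⟨ cong (_⊕ c₁) (⊕-comm a₁ a₂) ⟩
      (a₂ ⊕ a₁) ⊕ c₁ ≡⟨ ⊕-assoc a₂ a₁ c₁ ⟩
      a₂ ⊕ (a₁ ⊕ c₁) ≡⟨ cong (a₂ ⊕_) a₁⊕c₁ ⟩
      a₂ ⊕ s         ≡⟨ ⊕-comm a₂ s ⟩
      s ⊕ a₂         ∎
    recover-β₁ : (a₁ ⊕ c₁) ⊕ β₂ ≡ β₁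
    recover-β₁ = trans (cong (_⊕ β₂) a₁⊕c₁) (⊕-cancelʳ β₁ β₂)

  ∑-chain≡∑-sumCovers : ∀ β₂ →
    ∑ (allVecs n) (λ c₁ → toℕ (chain c₁ β₂)) ≡ ∑ (allVecs n) (λ β₁ → toℕ (sumCovers β₁ β₂))
  ∑-chain≡∑-sumCovers β₂ = begin
    ∑ (allVecs n) (λ c₁ → toℕ (chain c₁ β₂))
      ≡⟨ ∑-allVecs-⊕ n (β₂ ⊕ a₁) (λ c₁ → toℕ (chain c₁ β₂)) ⟩
    ∑ (allVecs n) (λ β₁ → toℕ (chain (β₁ ⊕ (β₂ ⊕ a₁)) β₂))
      ≡⟨ ∑-cong (λ β₁ → cong (λ c₁ → toℕ (chain c₁ β₂)) (⊕-assoc β₁ β₂ a₁)) (allVecs n) ⟨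
    ∑ (allVecs n) (λ β₁ → toℕ (chain ((β₁ ⊕ β₂) ⊕ a₁) β₂))
      ≡⟨ ∑-cong (λ β₁ → cong toℕ (chain-substitute β₁ β₂)) (allVecs n) ⟩
    ∑ (allVecs n) (λ β₁ → toℕ (sumCovers β₁ β₂)) ∎

lemma2p4 : (n : ℕ) (A : Subset n) (a₁ a₂ : F2^ n) →
    A a₁ ≡ true → A a₂ ≡ true →
    countPairs A (λ β₁ β₂ → A⟨ A ⟩ (β₁ ⊕ β₂) a₁ ∧ A⟨ A ⟩ (β₁ ⊕ β₂) a₂)
      ≡ countPairs A (λ c₁ β₂ → A⟨ A ⟩ (a₁ ⊕ a₂) c₁ ∧ A⟨ A ⟩ (a₁ ⊕ c₁) β₂)
lemma2p4 n A a₁ a₂ A∋a₁ A∋a₂ = begin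
  countPairs A _                            ≡⟨ countPairs≡∑∑ A _ ⟩
  ∑ 𝔽 (λ β₁ → ∑ 𝔽 (λ β₂ → toℕ (L β₁ β₂)))   ≡⟨ ∑-comm (λ β₁ β₂ → toℕ (L β₁ β₂)) 𝔽 𝔽 ⟩
  ∑ 𝔽 (λ β₂ → ∑ 𝔽 (λ β₁ → toℕ (L β₁ β₂)))   ≡⟨ ∑-cong (∑-chain≡∑-sumCovers A A∋a₁ A∋a₂) 𝔽 ⟨
  ∑ 𝔽 (λ β₂ → ∑ 𝔽 (λ c₁ → toℕ (R c₁ β₂)))   ≡⟨ ∑-comm (λ c₁ β₂ → toℕ (R c₁ β₂)) 𝔽 𝔽 ⟨
  ∑ 𝔽 (λ c₁ → ∑ 𝔽 (λ β₂ → toℕ (R c₁ β₂)))   ≡⟨ countPairs≡∑∑ A _ ⟨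
  countPairs A _                            ∎
  where
  𝔽 : List (F2^ n)
  𝔽 = allVecs n
  L R : F2^ n → F2^ n → Bool
  L = sumCovers A A∋a₁ A∋a₂
  R = chain A A∋a₁ A∋a₂
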